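{- Let $(G_i)_{i\in\mathbb{N}}$ and $(H_i)_{i\in\mathbb{N}}$ be sequences of games such that $G_i$ is Conway equivalent to $H_i$ for every $i\in\mathbb{N}$. Then $\sum^\bullet_{i\in\mathbb{N}} G_i$ is Conway equivalent to $\sum^\bullet_{i\in\mathbb{N}} H_i$.
   Context: Games are combinatorial games in Conway's sense: possibly infinite, partizan, Left and Right, no draws, no infinite runs, normal play. A game is written $\{G^L\mid G^R\}$; $+$ is the disjunctive sum; $G$ and $H$ are Conway equivalent iff $G-H$ is a second-player win. The sum $\sum^\bullet$. For a sequence $(H_i)_{i\in\mathbb{N}}$ and $n\in\mathbb{N}$, writing $H[i\mapsto K]$ for the sequence with $H_i$ replaced by $K$ and $H_0+\dots+H_j^L+\dots+H_m$ for the finite sum $H_0+\dots+H_m$ with $H_j$ replaced by a Left option of $H_j$, define (by transfinite induction on the natural sum of the birthdays of $H_0,\dots,H_n$) $(\sum^\bullet_i H_i)/R,n=\{\,(\sum^\bullet H[i\mapsto H_i^L])/R,n\ (i\le n),\ \ H_0+\dots+H_j^L+\dots+H_m\ (m\ge n,\ j\le m)\ \mid\ (\sum^\bullet H[i\mapsto H_i^R])/R,n\ (i\le n)\,\}$, $(\sum^\bullet_i H_i)/L,n=\{\,(\sum^\bullet H[i\mapsto H_i^L])/L,n\ (i\le n)\ \mid\ (\sum^\bullet H[i\mapsto H_i^R])/L,n\ (i\le n),\ \ H_0+\dots+H_j^R+\dots+H_m\ (m\ge n,\ j\le m)\,\}$, and $\sum^\bullet_{i\in\mathbb{N}} G_i=\{\,(\sum^\bullet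 G[i\mapsto G_i^L])/L,n\ (n\in\mathbb{N},\ i\le n)\mid(\sum^\bullet G[i\mapsto G_i^R])/R,n\ (n\in\mathbb{N},\ i\le n)\,\}$. Informally: the first player chooses $n$ and moves on some index $\le n$; thereafter both players move on indices $\le n$ until, at some turn of his, the second player chooses $m\ge n$ and moves on an index $\le m$; then play continues on the finite sum of the current positions of $G_0,\dots,G_m$. -}

module Defs where

open import Data.Nat using (ℕ; zero; suc; _≤_; _≡ᵇ_)
open import Data.Product using (Σ; _×_; _,_)
open import Data.Sum using (_⊎_; inj₁; inj₂; [_,_]′)
open import Data.Empty using (⊥; ⊥-elim)
open import Data.Vec using (Vec; []; _∷_)
open import Data.Bool using (if_then_else_)

-- Induction = well-foundedness (no infinite runs).

data Game : Set₁ where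
  mk : (L R : Set) → (L → Game) → (R → Game) → Game

LOpt : Game → Set
LOpt (mk L _ _ _) = L

ROpt : Game → Set
ROpt (mk _ R _ _) = R

leftOpt : (G : Game) → LOpt G → Game
leftOpt (mk _ _ gl _) = gl

rightOpt : (G : Game) → ROpt G → Game
rightOpt (mk _ _ _ gr) = gr

neg : Game → Game
neg (mk L R gl gr) = mk R L (λ r → neg (gr r)) (λ l → neg (gl l))

infixl 6 _+G_
_+G_ : Game → Game → Game
mk L R gl gr +G mk L' R' hl hr =
  mk (L ⊎ L') (R ⊎ R')
     [ (λ l → gl l +G mk L' R' hl hr) , (λ l → mk L R gl gr +G hl l) ]′
     [ (λ r → gr r +G mk L' R' hl hr) , (λ r → mk L R gl gr +G hr r) ]′

-- Winning (normal play), stated positively as existence of strategies.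

mutual
  LeftWinsFirst : Game → Set
  LeftWinsFirst (mk L R gl gr) = Σ L λ l → LeftWinsSecond (gl l)

  LeftWinsSecond : Game → Set
  LeftWinsSecond (mk L R gl gr) = (r : R) → LeftWinsFirst (gr r)

mutual
  RightWinsFirst : Game → Set
  RightWinsFirst (mk L R gl gr) = Σ R λ r → RightWinsSecond (gr r)

  RightWinsSecond : Game → Set
  RightWinsSecond (mk L R gl gr) = (l : L) → RightWinsFirst (gl l)

SecondPlayerWin : Game → Set
SecondPlayerWin G = LeftWinsSecond G × RightWinsSecond G

ConwayEquiv : Game → Game → Set
ConwayEquiv G H = SecondPlayerWin (G +G neg H)

update : (ℕ → Game) → ℕ → Game → (ℕ → Game)
update H j K i = if i ≡ᵇ j then K else H i

finSum : (ℕ → Game) → ℕ → Game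
finSum H zero = H zero
finSum H (suc m) = finSum H m +G H (suc m)

prefix : (k : ℕ) → (ℕ → Game) → Vec Game k
prefix zero H = []
prefix (suc k) H = H zero ∷ prefix k (λ i → H (suc i))

splice : ∀ {k} → Vec Game k → (ℕ → Game) → (ℕ → Game)
splice [] H i = H i
splice (g ∷ v) H zero = g
splice (g ∷ v) H (suc i) = splice v (λ j → H (suc j)) i

-- joint k X v : the game whose position is a vector v = (v_0,...,v_{k-1})
-- of component games; its Left (Right) options are
--   * a Left (Right) move in one component v_i, leading to
--     joint k X (v with v_i replaced by that option), and
--   * the Left (Right) options of the "extra" game X v.
-- (Defined by nested structural recursion, which is the transfinite
-- induction on the natural sum of birthdays of the components.)

joint : (k : ℕ) → (Vec Game k → Game) → Vec Game k → Game
joint zero X [] = X []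
joint (suc k) X (g ∷ w) = joint k (aux g) w
  where
  aux : Game → Vec Game k → Game
  aux (mk L R gl gr) w' with X (mk L R gl gr ∷ w')
  ... | mk EL ER el er =
    mk (L ⊎ EL) (R ⊎ ER)
       [ (λ l → joint k (aux (gl l)) w') , el ]′
       [ (λ r → joint k (aux (gr r)) w') , er ]′

exitLeft : ℕ → (ℕ → Game) → Game
exitLeft n K =
  mk (Σ ℕ λ m → n ≤ m × Σ ℕ λ j → j ≤ m × LOpt (K j)) ⊥
     (λ { (m , _ , j , _ , l) → finSum (update K j (leftOpt (K j) l)) m })
     ⊥-elim

exitRight : ℕ → (ℕ → Game) → Game
exitRight n K =
  mk ⊥ (Σ ℕ λ m → n ≤ m × Σ ℕ λ j → j ≤ m × ROpt (K j))
     ⊥-elim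
     (λ { (m , _ , j , _ , r) → finSum (update K j (rightOpt (K j) r)) m })

-- (Σ• H)/R,n : Right moved first; both move on indices ≤ n, Left may exit.
sumR : ℕ → (ℕ → Game) → Game
sumR n H = joint (suc n) (λ v → exitLeft n (splice v H)) (prefix (suc n) H)

-- (Σ• H)/L,n : Left moved first; both move on indices ≤ n, Right may exit.
sumL : ℕ → (ℕ → Game) → Game
sumL n H = joint (suc n) (λ v → exitRight n (splice v H)) (prefix (suc n) H)

sumBullet : (ℕ → Game) → Game
sumBullet G =
  mk (Σ ℕ λ n → Σ ℕ λ i → i ≤ n × LOpt (G i))
     (Σ ℕ λ n → Σ ℕ λ i → i ≤ n × ROpt (G i))
     (λ { (n , i , _ , l) → sumL n (update G i (leftOpt (G i) l)) })
     (λ { (n , i , _ , r) → sumR n (update G i (rightOpt (G i) r)) })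

-- The second player p of Σ• G − Σ• H wins by running the winning strategies for
-- the differences G i − H i side by side: whenever the opponent moves in component i
-- of either sum, p answers in component i, on whichever side the strategy for
-- G i − H i prescribes.  The phases of the two sums are kept in step (`Synced`): an
-- opening with bound n is mirrored with the same n, an exit with the same m, and
-- when the bounds differ p exits, with a bound covering both, as soon as he answers
-- in the sum the opponent did not move in.
-- Every round descends in the option order of the difference game, which is
-- well-founded.

module Submission where

open import Defs
open import Level as L using (Level)
open import Data.Nat using (ℕ; zero; suc; _≤_; _≡ᵇ_; z≤n; s≤s; _⊔_)
open import Data.Nat.Properties
  using (≡ᵇ⇒≡; ≡⇒≡ᵇ; _≟_; ≤-refl; ≤-trans; m≤n⇒m≤1+n; m≤n⇒m<n∨m≡n; m≤m⊔n; m≤n⊔m; <⇒≢)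
open import Data.Fin using (Fin; zero; suc; toℕ; fromℕ<)
open import Data.Fin.Properties using (toℕ≤pred[n]; toℕ-fromℕ<)
open import Data.Product using (Σ; _×_; _,_; proj₁; proj₂)
open import Data.Sum using (_⊎_; inj₁; inj₂; [_,_]′)
open import Data.Empty using (⊥-elim)
open import Data.Bool using (true; false)
open import Data.Vec using (Vec; []; _∷_; lookup; _[_]≔_)
open import Function using (_∘_)
open import Induction.WellFounded using (WellFounded; Acc; acc)
open import Relation.Nullary using (¬_; yes; no)
open import Relation.Binary.PropositionalEquality
  using (_≡_; _≢_; refl; sym; trans; cong; cong₂; subst)

private
  variable
    ℓ : Level

data Player : Set where
  left right : Player

data Opponents : Player → Player → Set where
  left-right : Opponents left right
  right-left : Opponents right left

opponents-sym : ∀ {p o} → Opponents p o → Opponents o p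
opponents-sym left-right = right-left
opponents-sym right-left = left-right

opponents-irrefl : ∀ {p} → ¬ Opponents p p
opponents-irrefl ()

Option : Player → Game → Set
Option left  = LOpt
Option right = ROpt

option : (x : Player) (G : Game) → Option x G → Game
option left  = leftOpt
option right = rightOpt

AllOptions : Player → Game → (Game → Set ℓ) → Set ℓ
AllOptions x G P = (o : Option x G) → P (option x G o)

AnyOption : Player → Game → (Game → Set ℓ) → Set ℓ
AnyOption x G P = Σ (Option x G) λ o → P (option x G o)

IsOption : Player → Game → Game → Set₁
IsOption x G g = Σ (Option x G) λ o → option x G o ≡ g

WinsFirst : Player → Game → Set
WinsFirst left  = LeftWinsFirst
WinsFirst right = RightWinsFirst

WinsSecond : Player → Game → Set
WinsSecond left  = LeftWinsSecond
WinsSecond right = RightWinsSecond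

winsSecond⁺ : ∀ {p o} → Opponents p o → (G : Game) → AllOptions o G (WinsFirst p) → WinsSecond p G
winsSecond⁺ left-right (mk _ _ _ _) h = h
winsSecond⁺ right-left (mk _ _ _ _) h = h

winsSecond⁻ : ∀ {p o} → Opponents p o → (G : Game) → WinsSecond p G → AllOptions o G (WinsFirst p)
winsSecond⁻ left-right (mk _ _ _ _) h = h
winsSecond⁻ right-left (mk _ _ _ _) h = h

winsFirst⁺ : (p : Player) (G : Game) → AnyOption p G (WinsSecond p) → WinsFirst p G
winsFirst⁺ left  (mk _ _ _ _) h = h
winsFirst⁺ right (mk _ _ _ _) h = h

winsFirst⁻ : (p : Player) (G : Game) → WinsFirst p G → AnyOption p G (WinsSecond p)
winsFirst⁻ left  (mk _ _ _ _) h = h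
winsFirst⁻ right (mk _ _ _ _) h = h

allOptions-+⁺ : (x : Player) (A B : Game) (P : Game → Set ℓ) →
  AllOptions x A (λ a → P (a +G B)) → AllOptions x B (λ b → P (A +G b)) → AllOptions x (A +G B) P
allOptions-+⁺ left  (mk _ _ _ _) (mk _ _ _ _) P ha hb (inj₁ o) = ha o
allOptions-+⁺ left  (mk _ _ _ _) (mk _ _ _ _) P ha hb (inj₂ o) = hb o
allOptions-+⁺ right (mk _ _ _ _) (mk _ _ _ _) P ha hb (inj₁ o) = ha o
allOptions-+⁺ right (mk _ _ _ _) (mk _ _ _ _) P ha hb (inj₂ o) = hb o

allOptions-+⁻ˡ : (x : Player) (A B : Game) (P : Game → Set ℓ) →
  AllOptions x (A +G B) P → AllOptions x A (λ a → P (a +G B))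
allOptions-+⁻ˡ left  (mk _ _ _ _) (mk _ _ _ _) P h o = h (inj₁ o)
allOptions-+⁻ˡ right (mk _ _ _ _) (mk _ _ _ _) P h o = h (inj₁ o)

allOptions-+⁻ʳ : (x : Player) (A B : Game) (P : Game → Set ℓ) →
  AllOptions x (A +G B) P → AllOptions x B (λ b → P (A +G b))
allOptions-+⁻ʳ left  (mk _ _ _ _) (mk _ _ _ _) P h o = h (inj₂ o)
allOptions-+⁻ʳ right (mk _ _ _ _) (mk _ _ _ _) P h o = h (inj₂ o)

anyOption-+⁺ : (x : Player) (A B : Game) (P : Game → Set ℓ) →
  AnyOption x A (λ a → P (a +G B)) ⊎ AnyOption x B (λ b → P (A +G b)) → AnyOption x (A +G B) P
anyOption-+⁺ left  (mk _ _ _ _) (mk _ _ _ _) P (inj₁ (o , h)) = inj₁ o , h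
anyOption-+⁺ left  (mk _ _ _ _) (mk _ _ _ _) P (inj₂ (o , h)) = inj₂ o , h
anyOption-+⁺ right (mk _ _ _ _) (mk _ _ _ _) P (inj₁ (o , h)) = inj₁ o , h
anyOption-+⁺ right (mk _ _ _ _) (mk _ _ _ _) P (inj₂ (o , h)) = inj₂ o , h

anyOption-+⁻ : (x : Player) (A B : Game) (P : Game → Set ℓ) →
  AnyOption x (A +G B) P → AnyOption x A (λ a → P (a +G B)) ⊎ AnyOption x B (λ b → P (A +G b))
anyOption-+⁻ left  (mk _ _ _ _) (mk _ _ _ _) P (inj₁ o , h) = inj₁ (o , h)
anyOption-+⁻ left  (mk _ _ _ _) (mk _ _ _ _) P (inj₂ o , h) = inj₂ (o , h)
anyOption-+⁻ right (mk _ _ _ _) (mk _ _ _ _) P (inj₁ o , h) = inj₁ (o , h)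
anyOption-+⁻ right (mk _ _ _ _) (mk _ _ _ _) P (inj₂ o , h) = inj₂ (o , h)

allOptions-neg⁺ : ∀ {x y} → Opponents x y → (B : Game) (P : Game → Set ℓ) →
  AllOptions y B (P ∘ neg) → AllOptions x (neg B) P
allOptions-neg⁺ left-right (mk _ _ _ _) P h = h
allOptions-neg⁺ right-left (mk _ _ _ _) P h = h

allOptions-neg⁻ : ∀ {x y} → Opponents x y → (B : Game) (P : Game → Set ℓ) →
  AllOptions x (neg B) P → AllOptions y B (P ∘ neg)
allOptions-neg⁻ left-right (mk _ _ _ _) P h = h
allOptions-neg⁻ right-left (mk _ _ _ _) P h = h

anyOption-neg⁺ : ∀ {x y} → Opponents x y → (B : Game) (P : Game → Set ℓ) →
  AnyOption y B (P ∘ neg) → AnyOption x (neg B) P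
anyOption-neg⁺ left-right (mk _ _ _ _) P h = h
anyOption-neg⁺ right-left (mk _ _ _ _) P h = h

anyOption-neg⁻ : ∀ {x y} → Opponents x y → (B : Game) (P : Game → Set ℓ) →
  AnyOption x (neg B) P → AnyOption y B (P ∘ neg)
anyOption-neg⁻ left-right (mk _ _ _ _) P h = h
anyOption-neg⁻ right-left (mk _ _ _ _) P h = h

WinsDifference : Player → Game → Game → Set
WinsDifference p A B = WinsSecond p (A +G neg B)

winsSecond-optionˡ : ∀ {p o} → Opponents p o → ∀ {A B g} →
  WinsDifference p A B → IsOption o A g → WinsFirst p (g +G neg B)
winsSecond-optionˡ {p} {o} opp {A} {B} w (a , refl) =
  allOptions-+⁻ˡ o A (neg B) (WinsFirst p) (winsSecond⁻ opp (A +G neg B) w) a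

winsSecond-optionʳ : ∀ {p o} → Opponents p o → ∀ {A B h} →
  WinsDifference p A B → IsOption p B h → WinsFirst p (A +G neg h)
winsSecond-optionʳ {p} {o} opp {A} {B} w (b , refl) =
  allOptions-neg⁻ (opponents-sym opp) B (λ b → WinsFirst p (A +G b))
    (allOptions-+⁻ʳ o A (neg B) (WinsFirst p) (winsSecond⁻ opp (A +G neg B) w)) b

winsFirst-difference⁻ : ∀ {p o} → Opponents p o → ∀ {A B} → WinsFirst p (A +G neg B) →
  AnyOption p A (λ a → WinsDifference p a B) ⊎ AnyOption o B (WinsDifference p A)
winsFirst-difference⁻ {p} opp {A} {B} w with anyOption-+⁻ p A (neg B) (WinsSecond p) (winsFirst⁻ p _ w)
... | inj₁ h = inj₁ h
... | inj₂ h = inj₂ (anyOption-neg⁻ opp B (λ b → WinsSecond p (A +G b)) h)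

data _≺_ (a : Game) (A : Game) : Set₁ where
  is-option : (x : Player) → IsOption x A a → a ≺ A

option-≺ : (x : Player) (A : Game) (o : Option x A) → option x A o ≺ A
option-≺ x A o = is-option x (o , refl)

+-monoˡ-≺ : ∀ {a A} (B : Game) → a ≺ A → (a +G B) ≺ (A +G B)
+-monoˡ-≺ {A = mk _ _ _ _} (mk _ _ _ _) (is-option left  (o , refl)) = option-≺ left  _ (inj₁ o)
+-monoˡ-≺ {A = mk _ _ _ _} (mk _ _ _ _) (is-option right (o , refl)) = option-≺ right _ (inj₁ o)

+-monoʳ-≺ : ∀ {b B} (A : Game) → b ≺ B → (A +G b) ≺ (A +G B)
+-monoʳ-≺ {B = mk _ _ _ _} (mk _ _ _ _) (is-option left  (o , refl)) = option-≺ left  _ (inj₂ o)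
+-monoʳ-≺ {B = mk _ _ _ _} (mk _ _ _ _) (is-option right (o , refl)) = option-≺ right _ (inj₂ o)

neg-mono-≺ : ∀ {b B} → b ≺ B → neg b ≺ neg B
neg-mono-≺ {B = mk _ _ _ _} (is-option left  (o , refl)) = option-≺ right _ o
neg-mono-≺ {B = mk _ _ _ _} (is-option right (o , refl)) = option-≺ left  _ o

allOptions-≺ : (x : Player) (A : Game) (P : Game → Set ℓ) →
  AllOptions x A (λ a → a ≺ A → P a) → AllOptions x A P
allOptions-≺ x A P h o = h o (option-≺ x A o)

anyOption-≺ : (x : Player) (A : Game) (P : Game → Set ℓ) →
  AnyOption x A (λ a → a ≺ A → P a) → AnyOption x A P
anyOption-≺ x A P (o , h) = o , h (option-≺ x A o)

≺-wellFounded : WellFounded _≺_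
≺-wellFounded (mk L R gl gr) = acc λ where
  (is-option left  (o , refl)) → ≺-wellFounded (gl o)
  (is-option right (o , refl)) → ≺-wellFounded (gr o)

record Updated (K : ℕ → Game) (i : ℕ) (g : Game) (K′ : ℕ → Game) : Set₁ where
  field
    at        : K′ i ≡ g
    elsewhere : ∀ {j} → j ≢ i → K′ j ≡ K j
open Updated

update-at : ∀ K i g → update K i g i ≡ g
update-at K i g with i ≡ᵇ i | ≡⇒≡ᵇ i i refl
... | true | _ = refl

update-elsewhere : ∀ K i g {j} → j ≢ i → update K i g j ≡ K j
update-elsewhere K i g {j} j≢i with j ≡ᵇ i | ≡ᵇ⇒≡ j i
... | false | _   = refl
... | true  | j≡i = ⊥-elim (j≢i (j≡i _))

update-updated : ∀ K i g → Updated K i g (update K i g)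
update-updated K i g = record { at = update-at K i g ; elsewhere = update-elsewhere K i g }

updated-resp : ∀ {K i g K′ K″} → (∀ j → K″ j ≡ K′ j) → Updated K i g K′ → Updated K i g K″
updated-resp K″≗K′ u =
  record { at = trans (K″≗K′ _) (at u) ; elsewhere = λ j≢i → trans (K″≗K′ _) (elsewhere u j≢i) }

finSum-cong : ∀ m {K K′ : ℕ → Game} → (∀ j → j ≤ m → K j ≡ K′ j) → finSum K m ≡ finSum K′ m
finSum-cong zero    eq = eq zero z≤n
finSum-cong (suc m) eq = cong₂ _+G_ (finSum-cong m λ j j≤m → eq j (m≤n⇒m≤1+n j≤m)) (eq (suc m) ≤-refl)

finSum-updated-below : ∀ {m j K g K′} → j ≤ m → Updated K j g K′ →
  finSum K′ (suc m) ≡ finSum K′ m +G K (suc m)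
finSum-updated-below j≤m u = cong (_ +G_) (elsewhere u λ m+1≡j → <⇒≢ (s≤s j≤m) (sym m+1≡j))

finSum-updated-last : ∀ {m K g K′} → Updated K (suc m) g K′ → finSum K′ (suc m) ≡ finSum K m +G g
finSum-updated-last {m} u =
  cong₂ _+G_ (finSum-cong m λ j j≤m → elsewhere u (<⇒≢ (s≤s j≤m))) (at u)

allOptions-finSum : (x : Player) (m : ℕ) (K : ℕ → Game) (P : Game → Set ℓ) →
  (∀ j → j ≤ m → (o : Option x (K j)) → ∀ K′ → Updated K j (option x (K j) o) K′ →
    P (finSum K′ m)) →
  AllOptions x (finSum K m) P
allOptions-finSum x zero K P h o = h zero z≤n o _ (update-updated K 0 _)
allOptions-finSum x (suc m) K P h =
  allOptions-+⁺ x (finSum K m) (K (suc m)) P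
    (allOptions-finSum x m K (λ a → P (a +G K (suc m))) λ j j≤m o K′ u →
      subst P (finSum-updated-below j≤m u) (h j (m≤n⇒m≤1+n j≤m) o K′ u))
    λ o → subst P (finSum-updated-last (update-updated K (suc m) _))
            (h (suc m) ≤-refl o _ (update-updated K (suc m) _))

anyOption-finSum : (x : Player) (m : ℕ) (K : ℕ → Game) {i : ℕ} → i ≤ m → (P : Game → Set ℓ) →
  AnyOption x (K i) (λ g → ∀ K′ → Updated K i g K′ → P (finSum K′ m)) →
  AnyOption x (finSum K m) P
anyOption-finSum x zero K z≤n P (o , h) = o , h _ (update-updated K 0 _)
anyOption-finSum x (suc m) K i≤m+1 P (o , h) with m≤n⇒m<n∨m≡n i≤m+1
... | inj₁ (s≤s i≤m) =
  anyOption-+⁺ x (finSum K m) (K (suc m)) P (inj₁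
    (anyOption-finSum x m K i≤m (λ a → P (a +G K (suc m)))
      (o , λ K′ u → subst P (finSum-updated-below i≤m u) (h K′ u))))
... | inj₂ refl =
  anyOption-+⁺ x (finSum K m) (K (suc m)) P (inj₂
    (o , subst P (finSum-updated-last (update-updated K (suc m) _)) (h _ (update-updated K (suc m) _))))

-- `joint` matches on its extra game; pre-composing with η-expand makes it reduce
-- for an extra game that is not syntactically a constructor.
η-expand : Game → Game
η-expand G = mk (LOpt G) (ROpt G) (leftOpt G) (rightOpt G)

-- joint (suc k) (η-expand ∘ X) (g ∷ w) unfolds to joint k (η-expand ∘ absorb-head X g) w.
absorb-head : ∀ {k} → (Vec Game (suc k) → Game) → Game → Vec Game k → Game
absorb-head {k} X g@(mk L R gl gr) w = mk (L ⊎ LOpt (X (g ∷ w))) (R ⊎ ROpt (X (g ∷ w)))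
  [ (λ l → joint (suc k) (η-expand ∘ X) (gl l ∷ w)) , leftOpt (X (g ∷ w)) ]′
  [ (λ r → joint (suc k) (η-expand ∘ X) (gr r ∷ w)) , rightOpt (X (g ∷ w)) ]′

allOptions-joint : (x : Player) (k : ℕ) (X : Vec Game k → Game) (v : Vec Game k) (P : Game → Set ℓ) →
  ((i : Fin k) (o : Option x (lookup v i)) →
    P (joint k (η-expand ∘ X) (v [ i ]≔ option x (lookup v i) o))) →
  AllOptions x (X v) P → AllOptions x (joint k (η-expand ∘ X) v) P
allOptions-joint left  zero X [] P _ hX = hX
allOptions-joint right zero X [] P _ hX = hX
allOptions-joint x (suc k) X (g@(mk L R gl gr) ∷ w) P hc hX =
  allOptions-joint x k (absorb-head X g) w P (hc ∘ suc) (last x (hc zero) hX)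
  where
  last : ∀ x → ((o : Option x g) → P (joint (suc k) (η-expand ∘ X) (option x g o ∷ w))) →
    AllOptions x (X (g ∷ w)) P → AllOptions x (absorb-head X g w) P
  last left  h₀ _  (inj₁ o) = h₀ o
  last left  _  hX (inj₂ e) = hX e
  last right h₀ _  (inj₁ o) = h₀ o
  last right _  hX (inj₂ e) = hX e

anyOption-joint : (x : Player) (k : ℕ) (X : Vec Game k → Game) (v : Vec Game k) (P : Game → Set ℓ) →
  (Σ (Fin k) λ i → AnyOption x (lookup v i) (λ g → P (joint k (η-expand ∘ X) (v [ i ]≔ g))))
    ⊎ AnyOption x (X v) P →
  AnyOption x (joint k (η-expand ∘ X) v) P
anyOption-joint x zero X [] P (inj₁ (() , _))
anyOption-joint left  zero X [] P (inj₂ h) = h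
anyOption-joint right zero X [] P (inj₂ h) = h
anyOption-joint x (suc k) X (g@(mk L R gl gr) ∷ w) P h =
  anyOption-joint x k (absorb-head X g) w P (shift x h)
  where
  shift : ∀ x →
    (Σ (Fin (suc k)) λ i → AnyOption x (lookup (g ∷ w) i)
       (λ g′ → P (joint (suc k) (η-expand ∘ X) ((g ∷ w) [ i ]≔ g′))))
      ⊎ AnyOption x (X (g ∷ w)) P →
    (Σ (Fin k) λ i → AnyOption x (lookup w i)
       (λ g′ → P (joint k (η-expand ∘ absorb-head X g) (w [ i ]≔ g′))))
      ⊎ AnyOption x (absorb-head X g w) P
  shift x     (inj₁ (suc i , h))     = inj₁ (i , h)
  shift left  (inj₁ (zero , o , h))  = inj₂ (inj₁ o , h)
  shift right (inj₁ (zero , o , h))  = inj₂ (inj₁ o , h)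
  shift left  (inj₂ (e , h))         = inj₂ (inj₂ e , h)
  shift right (inj₂ (e , h))         = inj₂ (inj₂ e , h)

splice-lookup : ∀ {k} (v : Vec Game k) (B : ℕ → Game) (i : Fin k) → splice v B (toℕ i) ≡ lookup v i
splice-lookup (g ∷ v) B zero    = refl
splice-lookup (g ∷ v) B (suc i) = splice-lookup v (B ∘ suc) i

splice-[]≔ : ∀ {k} (v : Vec Game k) (B : ℕ → Game) (i : Fin k) (g : Game) →
  Updated (splice v B) (toℕ i) g (splice (v [ i ]≔ g) B)
splice-[]≔ (_ ∷ v) B zero g = record
  { at = refl ; elsewhere = λ { {zero} 0≢0 → ⊥-elim (0≢0 refl) ; {suc j} _ → refl } }
splice-[]≔ (_ ∷ v) B (suc i) g = record
  { at = at u ; elsewhere = λ { {zero} _ → refl ; {suc j} j≢i → elsewhere u (j≢i ∘ cong suc) } }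
  where u = splice-[]≔ v (B ∘ suc) i g

splice-prefix : ∀ k (B : ℕ → Game) j → splice (prefix k B) B j ≡ B j
splice-prefix zero    B j       = refl
splice-prefix (suc k) B zero    = refl
splice-prefix (suc k) B (suc j) = splice-prefix k (B ∘ suc) j

exits : Player → ℕ → (ℕ → Game) → Game
exits left  = exitLeft
exits right = exitRight

allOptions-exits : (x q : Player) {n : ℕ} (K : ℕ → Game) (P : Game → Set ℓ) →
  (q ≡ x → ∀ {m j} → n ≤ m → j ≤ m → (o : Option x (K j)) →
    P (finSum (update K j (option x (K j) o)) m)) →
  AllOptions x (exits q n K) P
allOptions-exits left  left  K P h (m , n≤m , j , j≤m , o) = h refl n≤m j≤m o
allOptions-exits left  right K P h ()
allOptions-exits right left  K P h ()
allOptions-exits right right K P h (m , n≤m , j , j≤m , o) = h refl n≤m j≤m o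

anyOption-exits : (x : Player) {n m i : ℕ} (K : ℕ → Game) (P : Game → Set ℓ) → n ≤ m → i ≤ m →
  AnyOption x (K i) (λ g → P (finSum (update K i g) m)) → AnyOption x (exits x n K) P
anyOption-exits left  K P n≤m i≤m (o , h) = (_ , n≤m , _ , i≤m , o) , h
anyOption-exits right K P n≤m i≤m (o , h) = (_ , n≤m , _ , i≤m , o) , h

-- A position of Σ• reached after finitely many moves.  In `bounded q n B v` the
-- components 0..n are at positions v, the others at positions B, and q is the
-- player (the one who did not open) who may exit to a finite sum.
data Phase : Set₁ where
  start   : (K : ℕ → Game) → Phase
  bounded : (q : Player) (n : ℕ) (B : ℕ → Game) (v : Vec Game (suc n)) → Phase
  finite  : (m : ℕ) (K : ℕ → Game) → Phase

⟦_⟧ : Phase → Game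
⟦ start K ⟧         = sumBullet K
⟦ bounded q n B v ⟧ = joint (suc n) (λ w → η-expand (exits q n (splice w B))) v
⟦ finite m K ⟧      = finSum K m

components : Phase → ℕ → Game
components (start K)         = K
components (bounded q n B v) = splice v B
components (finite m K)      = K

-- The player y, the opponent of x, is the one allowed to exit after an opening by x.
data Plan (x y : Player) : Phase → ℕ → Set₁ where
  plan-open    : ∀ {K i} (n : ℕ) → i ≤ n → Plan x y (start K) i
  plan-bounded : ∀ {q n B v i} → i ≤ n → Plan x y (bounded q n B v) i
  plan-exit    : ∀ {q n B v i} (m : ℕ) → q ≡ x → n ≤ m → i ≤ m → Plan x y (bounded q n B v) i
  plan-finite  : ∀ {m K i} → i ≤ m → Plan x y (finite m K) i

Realises : ∀ {x y ph i} → Plan x y ph i → Phase → Set₁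
Realises {y = y} (plan-open n _)  ph′ = Σ (ℕ → Game) λ B → Σ (Vec Game (suc n)) λ v → ph′ ≡ bounded y n B v
Realises (plan-bounded {q} {n} _) ph′ = Σ (ℕ → Game) λ B → Σ (Vec Game (suc n)) λ v → ph′ ≡ bounded q n B v
Realises (plan-exit m _ _ _)      ph′ = Σ (ℕ → Game) λ K → ph′ ≡ finite m K
Realises (plan-finite {m} _)      ph′ = Σ (ℕ → Game) λ K → ph′ ≡ finite m K

Step : (x y : Player) → Phase → Phase → ℕ → Set₁
Step x y ph ph′ i = Σ (Plan x y ph i) λ pl → Realises pl ph′

AllSteps : (x y : Player) → Phase → (Game → Set ℓ) → Set (L.suc L.zero L.⊔ ℓ)
AllSteps x y ph P = ∀ {ph′ i g} →
  IsOption x (components ph i) g → Updated (components ph) i g (components ph′) → Step x y ph ph′ i → P ⟦ ph′ ⟧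

AfterPlan : ∀ {x y ph i} → Plan x y ph i → (Game → Set ℓ) → Game → Set (L.suc L.zero L.⊔ ℓ)
AfterPlan {ph = ph} {i} pl P g =
  ∀ ph′ → Updated (components ph) i g (components ph′) → Realises pl ph′ → P ⟦ ph′ ⟧

opening-updated : ∀ K i g k → Updated K i g (splice (prefix k (update K i g)) (update K i g))
opening-updated K i g k = updated-resp (splice-prefix k (update K i g)) (update-updated K i g)

allOptions-phase : ∀ {x y} → Opponents x y → (ph : Phase) (P : Game → Set ℓ) → AllSteps x y ph P →
  AllOptions x ⟦ ph ⟧ P
allOptions-phase left-right (start K) P h (n , i , i≤n , o) =
  h (o , refl) (opening-updated K i _ (suc n)) (plan-open n i≤n , _ , prefix (suc n) (update K i _) , refl)
allOptions-phase right-left (start K) P h (n , i , i≤n , o) =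
  h (o , refl) (opening-updated K i _ (suc n)) (plan-open n i≤n , _ , prefix (suc n) (update K i _) , refl)
allOptions-phase {x = x} _ (bounded q n B v) P h =
  allOptions-joint x (suc n) (λ w → exits q n (splice w B)) v P
    (λ i o → h (subst (λ A → IsOption x A _) (sym (splice-lookup v B i)) (o , refl))
               (splice-[]≔ v B i _) (plan-bounded (toℕ≤pred[n] i) , B , v [ i ]≔ _ , refl))
    (allOptions-exits x q (splice v B) P λ q≡x n≤m j≤m o →
      h (o , refl) (update-updated (splice v B) _ _) (plan-exit _ q≡x n≤m j≤m , _ , refl))
allOptions-phase {x = x} _ (finite m K) P h =
  allOptions-finSum x m K P λ j j≤m o K′ u → h (o , refl) u (plan-finite j≤m , K′ , refl)

anyOption-bounded : (x q : Player) (n : ℕ) (B : ℕ → Game) (v : Vec Game (suc n)) {i : ℕ} → i ≤ n →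
  (P : Game → Set ℓ) →
  AnyOption x (splice v B i)
    (λ g → ∀ v′ → Updated (splice v B) i g (splice v′ B) → P ⟦ bounded q n B v′ ⟧) →
  AnyOption x ⟦ bounded q n B v ⟧ P
anyOption-bounded x q n B v i≤n P (o , k) with fromℕ< (s≤s i≤n) | toℕ-fromℕ< (s≤s i≤n)
... | i | refl =
  anyOption-joint x (suc n) (λ w → exits q n (splice w B)) v P (inj₁ (i ,
    subst (λ A → AnyOption x A (λ g → P ⟦ bounded q n B (v [ i ]≔ g) ⟧)) (splice-lookup v B i)
      (o , k (v [ i ]≔ _) (splice-[]≔ v B i _))))

anyOption-phase : ∀ {x y} → Opponents x y → (ph : Phase) (i : ℕ) (pl : Plan x y ph i) (P : Game → Set ℓ) →
  AnyOption x (components ph i) (AfterPlan pl P) → AnyOption x ⟦ ph ⟧ P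
anyOption-phase left-right (start K) i (plan-open n i≤n) P (o , h) =
  (n , i , i≤n , o) , h _ (opening-updated K i _ (suc n)) (_ , prefix (suc n) (update K i _) , refl)
anyOption-phase right-left (start K) i (plan-open n i≤n) P (o , h) =
  (n , i , i≤n , o) , h _ (opening-updated K i _ (suc n)) (_ , prefix (suc n) (update K i _) , refl)
anyOption-phase {x = x} _ (bounded q n B v) i (plan-bounded i≤n) P (o , h) =
  anyOption-bounded x q n B v i≤n P (o , λ v′ u → h _ u (B , v′ , refl))
anyOption-phase {x = x} _ (bounded q n B v) i (plan-exit m refl n≤m i≤m) P (o , h) =
  anyOption-joint x (suc n) (λ w → exits x n (splice w B)) v P (inj₂
    (anyOption-exits x (splice v B) P n≤m i≤m (o , h _ (update-updated (splice v B) i _) (_ , refl))))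
anyOption-phase {x = x} _ (finite m K) i (plan-finite i≤m) P (o , h) =
  anyOption-finSum x m K i≤m P (o , λ K′ u → h _ u (K′ , refl))

-- The invariant on a ⊖ b kept by the second player p.  Letters give the phase of
-- a and of b: S start, F finite, P / O bounded with p / o allowed to exit.
data Synced (p o : Player) : Phase → Phase → Set₁ where
  SS : ∀ {K₁ K₂} → Synced p o (start K₁) (start K₂)
  PS : ∀ {n B v K} → Synced p o (bounded p n B v) (start K)
  SO : ∀ {K n B v} → Synced p o (start K) (bounded o n B v)
  PO : ∀ {n B v n′ B′ v′} → Synced p o (bounded p n B v) (bounded o n′ B′ v′)
  PP : ∀ {n B v B′ v′} → Synced p o (bounded p n B v) (bounded p n B′ v′)
  OO : ∀ {n B v B′ v′} → Synced p o (bounded o n B v) (bounded o n B′ v′)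
  PF : ∀ {n B v m K} → n ≤ m → Synced p o (bounded p n B v) (finite m K)
  FO : ∀ {m K n B v} → n ≤ m → Synced p o (finite m K) (bounded o n B v)
  FF : ∀ {m K₁ K₂} → Synced p o (finite m K₁) (finite m K₂)

record Response (x y : Player) (ph : Phase) (i : ℕ) (Inv : Phase → Set₁) : Set₁ where
  constructor reply
  field
    plan : Plan x y ph i
    next : ∀ ph′ → Realises plan ph′ → Inv ph′
open Response

-- After o moves in component i of a, p can keep the invariant whether his
-- winning answer in that component is on the side of a or of b.
respondˡ : ∀ {p o} → Opponents p o → ∀ {a b a′ i} → Synced p o a b → Step o p a a′ i →
  Response p o a′ i (λ a″ → Synced p o a″ b) × Response o p b i (λ b′ → Synced p o a′ b′)
respondˡ _ SS (plan-open n i≤n , _ , _ , refl) =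
  reply (plan-bounded i≤n) (λ { _ (_ , _ , refl) → PS }) ,
  reply (plan-open n i≤n) (λ { _ (_ , _ , refl) → PP })
respondˡ _ PS (plan-bounded {n = n} i≤n , _ , _ , refl) =
  reply (plan-bounded i≤n) (λ { _ (_ , _ , refl) → PS }) ,
  reply (plan-open n i≤n) (λ { _ (_ , _ , refl) → PP })
respondˡ opp PS (plan-exit _ refl _ _ , _ , refl) = ⊥-elim (opponents-irrefl opp)
respondˡ _ (SO {n = n}) (plan-open n′ i≤n′ , _ , _ , refl) =
  reply (plan-bounded i≤n′) (λ { _ (_ , _ , refl) → PO }) ,
  reply (plan-exit (n′ ⊔ n) refl (m≤n⊔m n′ n) (≤-trans i≤n′ (m≤m⊔n n′ n)))
    (λ { _ (_ , refl) → PF (m≤m⊔n n′ n) })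
respondˡ _ (PO {n = n} {n′ = n′}) (plan-bounded i≤n , _ , _ , refl) =
  reply (plan-bounded i≤n) (λ { _ (_ , _ , refl) → PO }) ,
  reply (plan-exit (n ⊔ n′) refl (m≤n⊔m n n′) (≤-trans i≤n (m≤m⊔n n n′)))
    (λ { _ (_ , refl) → PF (m≤m⊔n n n′) })
respondˡ opp PO (plan-exit _ refl _ _ , _ , refl) = ⊥-elim (opponents-irrefl opp)
respondˡ _ PP (plan-bounded i≤n , _ , _ , refl) =
  reply (plan-bounded i≤n) (λ { _ (_ , _ , refl) → PP }) ,
  reply (plan-bounded i≤n) (λ { _ (_ , _ , refl) → PP })
respondˡ opp PP (plan-exit _ refl _ _ , _ , refl) = ⊥-elim (opponents-irrefl opp)
respondˡ _ OO (plan-bounded i≤n , _ , _ , refl) =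
  reply (plan-bounded i≤n) (λ { _ (_ , _ , refl) → OO }) ,
  reply (plan-bounded i≤n) (λ { _ (_ , _ , refl) → OO })
respondˡ _ OO (plan-exit m refl n≤m i≤m , _ , refl) =
  reply (plan-finite i≤m) (λ { _ (_ , refl) → FO n≤m }) ,
  reply (plan-exit m refl n≤m i≤m) (λ { _ (_ , refl) → FF })
respondˡ _ (PF n≤m) (plan-bounded i≤n , _ , _ , refl) =
  reply (plan-bounded i≤n) (λ { _ (_ , _ , refl) → PF n≤m }) ,
  reply (plan-finite (≤-trans i≤n n≤m)) (λ { _ (_ , refl) → PF n≤m })
respondˡ opp (PF _) (plan-exit _ refl _ _ , _ , refl) = ⊥-elim (opponents-irrefl opp)
respondˡ _ (FO {m = m} n≤m) (plan-finite i≤m , _ , refl) =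
  reply (plan-finite i≤m) (λ { _ (_ , refl) → FO n≤m }) ,
  reply (plan-exit m refl n≤m i≤m) (λ { _ (_ , refl) → FF })
respondˡ _ FF (plan-finite i≤m , _ , refl) =
  reply (plan-finite i≤m) (λ { _ (_ , refl) → FF }) ,
  reply (plan-finite i≤m) (λ { _ (_ , refl) → FF })

respondʳ : ∀ {p o} → Opponents p o → ∀ {a b b′ i} → Synced p o a b → Step p o b b′ i →
  Response p o a i (λ a′ → Synced p o a′ b′) × Response o p b′ i (λ b″ → Synced p o a b″)
respondʳ _ SS (plan-open n i≤n , _ , _ , refl) =
  reply (plan-open n i≤n) (λ { _ (_ , _ , refl) → OO }) ,
  reply (plan-bounded i≤n) (λ { _ (_ , _ , refl) → SO })
respondʳ _ (PS {n = n}) (plan-open n′ i≤n′ , _ , _ , refl) =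
  reply (plan-exit (n ⊔ n′) refl (m≤m⊔n n n′) (≤-trans i≤n′ (m≤n⊔m n n′)))
    (λ { _ (_ , refl) → FO (m≤n⊔m n n′) }) ,
  reply (plan-bounded i≤n′) (λ { _ (_ , _ , refl) → PO })
respondʳ _ SO (plan-bounded {n = n} i≤n , _ , _ , refl) =
  reply (plan-open n i≤n) (λ { _ (_ , _ , refl) → OO }) ,
  reply (plan-bounded i≤n) (λ { _ (_ , _ , refl) → SO })
respondʳ opp SO (plan-exit _ refl _ _ , _ , refl) = ⊥-elim (opponents-irrefl opp)
respondʳ _ (PO {n = n} {n′ = n′}) (plan-bounded i≤n′ , _ , _ , refl) =
  reply (plan-exit (n ⊔ n′) refl (m≤m⊔n n n′) (≤-trans i≤n′ (m≤n⊔m n n′)))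
    (λ { _ (_ , refl) → FO (m≤n⊔m n n′) }) ,
  reply (plan-bounded i≤n′) (λ { _ (_ , _ , refl) → PO })
respondʳ opp PO (plan-exit _ refl _ _ , _ , refl) = ⊥-elim (opponents-irrefl opp)
respondʳ _ PP (plan-bounded i≤n , _ , _ , refl) =
  reply (plan-bounded i≤n) (λ { _ (_ , _ , refl) → PP }) ,
  reply (plan-bounded i≤n) (λ { _ (_ , _ , refl) → PP })
respondʳ _ PP (plan-exit m refl n≤m i≤m , _ , refl) =
  reply (plan-exit m refl n≤m i≤m) (λ { _ (_ , refl) → FF }) ,
  reply (plan-finite i≤m) (λ { _ (_ , refl) → PF n≤m })
respondʳ _ OO (plan-bounded i≤n , _ , _ , refl) =
  reply (plan-bounded i≤n) (λ { _ (_ , _ , refl) → OO }) ,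
  reply (plan-bounded i≤n) (λ { _ (_ , _ , refl) → OO })
respondʳ opp OO (plan-exit _ refl _ _ , _ , refl) = ⊥-elim (opponents-irrefl opp)
respondʳ _ (PF {m = m} n≤m) (plan-finite i≤m , _ , refl) =
  reply (plan-exit m refl n≤m i≤m) (λ { _ (_ , refl) → FF }) ,
  reply (plan-finite i≤m) (λ { _ (_ , refl) → PF n≤m })
respondʳ _ (FO n≤m) (plan-bounded i≤n , _ , _ , refl) =
  reply (plan-finite (≤-trans i≤n n≤m)) (λ { _ (_ , refl) → FO n≤m }) ,
  reply (plan-bounded i≤n) (λ { _ (_ , _ , refl) → FO n≤m })
respondʳ opp (FO _) (plan-exit _ refl _ _ , _ , refl) = ⊥-elim (opponents-irrefl opp)
respondʳ _ FF (plan-finite i≤m , _ , refl) =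
  reply (plan-finite i≤m) (λ { _ (_ , refl) → FF }) ,
  reply (plan-finite i≤m) (λ { _ (_ , refl) → FF })

pointwise-updated-elsewhere : (R : Game → Game → Set ℓ) {K M K′ : ℕ → Game} {i : ℕ} {g : Game} →
  Updated K i g K′ → (∀ j → R (K j) (M j)) → ∀ {j} → j ≢ i → R (K′ j) (M j)
pointwise-updated-elsewhere R u rs {j} j≢i = subst (λ A → R A _) (sym (elsewhere u j≢i)) (rs j)

pointwise-updated : (R : Game → Game → Set ℓ) {K M K′ : ℕ → Game} {i : ℕ} {g : Game} →
  Updated K i g K′ → (∀ {j} → j ≢ i → R (K j) (M j)) → R g (M i) → ∀ j → R (K′ j) (M j)
pointwise-updated R {i = i} u rs r j with j ≟ i
... | yes refl = subst (λ A → R A _) (sym (at u)) r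
... | no j≢i   = subst (λ A → R A _) (sym (elsewhere u j≢i)) (rs j≢i)

_⊖_ : Phase → Phase → Game
a ⊖ b = ⟦ a ⟧ +G neg ⟦ b ⟧

ComponentsWin : Player → Phase → Phase → Set
ComponentsWin p a b = ∀ j → WinsDifference p (components a j) (components b j)

ComponentsWinExcept : Player → ℕ → Phase → Phase → Set
ComponentsWinExcept p i a b = ∀ {j} → j ≢ i → WinsDifference p (components a j) (components b j)

WinsBelow : Player → Player → Game → Set₁
WinsBelow p o D = ∀ {a b} → Synced p o a b → ComponentsWin p a b → (a ⊖ b) ≺ D → WinsSecond p (a ⊖ b)

replyˡ : ∀ {p o} → Opponents p o → ∀ {a b i} → Response p o a i (λ a′ → Synced p o a′ b) →
  ComponentsWinExcept p i a b → AnyOption p (components a i) (λ g → WinsDifference p g (components b i)) →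
  WinsBelow p o (a ⊖ b) → WinsFirst p (a ⊖ b)
replyˡ {p} opp {a} {b} c wins (g , win) ih =
  winsFirst⁺ p _ (anyOption-+⁺ p ⟦ a ⟧ (neg ⟦ b ⟧) (WinsSecond p) (inj₁
    (anyOption-≺ p ⟦ a ⟧ P (anyOption-phase opp a _ (plan c) (λ A → A ≺ ⟦ a ⟧ → P A)
      (g , λ a′ u r lt →
        ih (next c a′ r) (pointwise-updated (WinsDifference p) u wins win) (+-monoˡ-≺ _ lt))))))
  where P = λ A → WinsDifference p A ⟦ b ⟧

replyʳ : ∀ {p o} → Opponents p o → ∀ {a b i} → Response o p b i (λ b′ → Synced p o a b′) →
  ComponentsWinExcept p i a b → AnyOption o (components b i) (λ h → WinsDifference p (components a i) h) →
  WinsBelow p o (a ⊖ b) → WinsFirst p (a ⊖ b)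
replyʳ {p} {o} opp {a} {b} c wins (h , win) ih =
  winsFirst⁺ p _ (anyOption-+⁺ p ⟦ a ⟧ (neg ⟦ b ⟧) (WinsSecond p) (inj₂
    (anyOption-neg⁺ opp ⟦ b ⟧ (λ B → WinsSecond p (⟦ a ⟧ +G B)) (anyOption-≺ o ⟦ b ⟧ P
      (anyOption-phase (opponents-sym opp) b _ (plan c) (λ B → B ≺ ⟦ b ⟧ → P B) (h , λ b′ u r lt →
        ih (next c b′ r) (pointwise-updated (λ B A → WinsDifference p A B) u wins win)
           (+-monoʳ-≺ _ (neg-mono-≺ lt))))))))
  where P = WinsDifference p ⟦ a ⟧

answerˡ : ∀ {p o} → Opponents p o → ∀ {a b} → Synced p o a b → ComponentsWin p a b →
  (∀ {C} → C ≺ (a ⊖ b) → WinsBelow p o C) →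
  AllSteps o p a (λ A → A ≺ ⟦ a ⟧ → WinsFirst p (A +G neg ⟦ b ⟧))
answerˡ {p} {o} opp {a} {b} sync wins ih {i = i} isOpt u step lt =
  [ (λ r → replyˡ opp (proj₁ responses) except
             (subst (λ A → AnyOption p A (λ g → WinsDifference p g (components b i))) (sym (at u)) r) ih′)
  , (λ r → replyʳ opp (proj₂ responses) except
             (subst (λ A → AnyOption o (components b i) (WinsDifference p A)) (sym (at u)) r) ih′)
  ]′ (winsFirst-difference⁻ opp (winsSecond-optionˡ opp (wins i) isOpt))
  where
  responses = respondˡ opp sync step
  except = pointwise-updated-elsewhere (WinsDifference p) u wins
  ih′ = ih (+-monoˡ-≺ _ lt)

answerʳ : ∀ {p o} → Opponents p o → ∀ {a b} → Synced p o a b → ComponentsWin p a b →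
  (∀ {C} → C ≺ (a ⊖ b) → WinsBelow p o C) →
  AllSteps p o b (λ B → B ≺ ⟦ b ⟧ → WinsFirst p (⟦ a ⟧ +G neg B))
answerʳ {p} {o} opp {a} {b} sync wins ih {i = i} isOpt u step lt =
  [ (λ r → replyˡ opp (proj₁ responses) except
             (subst (λ B → AnyOption p (components a i) (λ g → WinsDifference p g B)) (sym (at u)) r) ih′)
  , (λ r → replyʳ opp (proj₂ responses) except
             (subst (λ B → AnyOption o B (WinsDifference p (components a i))) (sym (at u)) r) ih′)
  ]′ (winsFirst-difference⁻ opp (winsSecond-optionʳ opp (wins i) isOpt))
  where
  responses = respondʳ opp sync step
  except = pointwise-updated-elsewhere (λ B A → WinsDifference p A B) u wins
  ih′ = ih (+-monoʳ-≺ _ (neg-mono-≺ lt))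

-- A round, the opponent's move followed by p's answer, descends two steps in ≺.
winsSecond-step : ∀ {p o} → Opponents p o → ∀ {a b} → Synced p o a b → ComponentsWin p a b →
  (∀ {C} → C ≺ (a ⊖ b) → WinsBelow p o C) → WinsSecond p (a ⊖ b)
winsSecond-step {p} {o} opp {a} {b} sync wins ih =
  winsSecond⁺ opp (a ⊖ b) (allOptions-+⁺ o ⟦ a ⟧ (neg ⟦ b ⟧) (WinsFirst p)
    (allOptions-≺ o ⟦ a ⟧ Pˡ (allOptions-phase (opponents-sym opp) a (λ A → A ≺ ⟦ a ⟧ → Pˡ A)
      (answerˡ opp sync wins ih)))
    (allOptions-neg⁺ (opponents-sym opp) ⟦ b ⟧ (λ B → WinsFirst p (⟦ a ⟧ +G B))
      (allOptions-≺ p ⟦ b ⟧ Pʳ (allOptions-phase opp b (λ B → B ≺ ⟦ b ⟧ → Pʳ B)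
        (answerʳ opp sync wins ih)))))
  where
  Pˡ = λ A → WinsFirst p (A +G neg ⟦ b ⟧)
  Pʳ = λ B → WinsFirst p (⟦ a ⟧ +G neg B)

winsSecond-⊖ : ∀ {p o} → Opponents p o → ∀ {a b} → Synced p o a b → ComponentsWin p a b →
  Acc _≺_ (a ⊖ b) → WinsSecond p (a ⊖ b)
winsSecond-⊖ {p} {o} opp sync wins (acc below) = winsSecond-step opp sync wins (winsBelow ∘ below)
  where
  winsBelow : ∀ {C} → Acc _≺_ C → WinsBelow p o C
  winsBelow (acc below′) sync′ wins′ lt = winsSecond-⊖ opp sync′ wins′ (below′ lt)

theorem6p3 : (G H : ℕ → Game) → ((i : ℕ) → ConwayEquiv (G i) (H i))
    → ConwayEquiv (sumBullet G) (sumBullet H)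
theorem6p3 G H G≈H =
  winsSecond-⊖ left-right SS (proj₁ ∘ G≈H) (≺-wellFounded _) ,
  winsSecond-⊖ right-left SS (proj₂ ∘ G≈H) (≺-wellFounded _)
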